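{- For every integer $m\ge0$, $$2^{m}=\frac{2m}{m+1}\sum_{j=0}^{m-1}(-1)^j\binom{m-1}{j}\binom{4m-2j+1}{m-1}+\frac{1}{m+1}\sum_{j=0}^{m}(-1)^j\binom{m}{j}\binom{4m-2j+2}{m}.$$
   Context: Empty sums are $0$. -}

module Defs where

open import Data.Nat using (ℕ; zero; suc)
open import Data.Integer using (ℤ; _+_; _*_; -_; +_; 0ℤ; 1ℤ)

sumBelow : ℕ → (ℕ → ℤ) → ℤ
sumBelow zero    f = 0ℤ
sumBelow (suc n) f = sumBelow n f + f n

sign : ℕ → ℤ
sign zero    = 1ℤ
sign (suc j) = - sign j

-- With ∇₂ f x = f x − f (x − 2), the sum Σⱼ (−1)ʲ C(n,j) f(x − 2j) is ∇₂ⁿ f evaluated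
-- at x.  Two applications of Pascal's rule give ∇₂ C(·, n+1) = C(· − 1, n) + C(· − 2, n)
-- away from the origin, so for x ≥ 2n induction on n shows ∇₂ⁿ C(·, n) (x) = 2ⁿ.  The
-- two sums in the statement are therefore 2^(m−1) and 2^m, and
-- (2m/(m+1))·2^(m−1) + (1/(m+1))·2^m = 2^m.
module Submission where

open import Defs
open import Data.Nat as ℕ using (ℕ; _∸_; suc; _^_)
open import Data.Nat.Combinatorics using (_C_)
open import Data.Integer as ℤ using (ℤ; +_)
open import Data.Rational as ℚ using (ℚ; _/_)
open import Relation.Binary.PropositionalEquality using (_≡_)

open import Data.Nat using (zero; _≤_; _<_; z≤n; s≤s)
import Data.Nat.Properties as ℕ
open import Data.Nat.Combinatorics using (nCk+nC[k+1]≡[n+1]C[k+1])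
open import Data.Nat.Combinatorics.Specification using (k>n⇒nCk≡0)
open import Data.Integer using (_+_; _*_; _-_; 0ℤ; 1ℤ)
import Data.Integer.Properties as ℤ
open import Data.Integer.Solver using (module +-*-Solver)
open import Data.Rational.Unnormalised as ℚᵘ using (ℚᵘ; mkℚᵘ; *≡*)
import Data.Rational.Unnormalised.Properties as ℚᵘ
import Data.Rational.Properties as ℚ
open import Function using (_∘_)
open import Relation.Binary.PropositionalEquality using (refl; sym; trans; cong; cong₂; module ≡-Reasoning)

2m/[1+m]*a+1/[1+m]*2a≃2a : ∀ m a →
  mkℚᵘ (+ (2 ℕ.* m)) m ℚᵘ.* mkℚᵘ (+ a) 0 ℚᵘ.+ mkℚᵘ (+ 1) m ℚᵘ.* mkℚᵘ (+ (2 ℕ.* a)) 0 ℚᵘ.≃ mkℚᵘ (+ (2 ℕ.* a)) 0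
2m/[1+m]*a+1/[1+m]*2a≃2a m a = *≡* (begin
  (+ (2 ℕ.* m) * + a * d + + 1 * + (2 ℕ.* a) * d) * + 1
    ≡⟨ cong₂ (λ 2m 2a → (2m * + a * d + + 1 * 2a * d) * + 1) (ℤ.pos-* 2 m) (ℤ.pos-* 2 a) ⟩
  (+ 2 * + m * + a * d + + 1 * (+ 2 * + a) * d) * + 1
    ≡⟨ cong (λ e → (+ 2 * + m * + a * e + + 1 * (+ 2 * + a) * e) * + 1) d≡1+m ⟩
  (+ 2 * + m * + a * + suc m + + 1 * (+ 2 * + a) * + suc m) * + 1
    ≡⟨ solve 2 (λ m a → (con (+ 2) :* m :* a :* (con (+ 1) :+ m) :+ con (+ 1) :* (con (+ 2) :* a) :* (con (+ 1) :+ m)) :* con (+ 1)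
                       := con (+ 2) :* a :* ((con (+ 1) :+ m) :* (con (+ 1) :+ m))) refl (+ m) (+ a) ⟩
  + 2 * + a * (+ suc m * + suc m)
    ≡⟨ cong₂ (λ 2a e → 2a * (e * e)) (sym (ℤ.pos-* 2 a)) (sym d≡1+m) ⟩
  + (2 ℕ.* a) * (d * d)
    ≡⟨ cong (+ (2 ℕ.* a) *_) (sym (ℤ.pos-* (suc m ℕ.* 1) (suc m ℕ.* 1))) ⟩
  + (2 ℕ.* a) * + (suc m ℕ.* 1 ℕ.* (suc m ℕ.* 1)) ∎)
  where
  open +-*-Solver
  open ≡-Reasoning

  d : ℤ
  d = + (suc m ℕ.* 1)

  d≡1+m : d ≡ + suc m
  d≡1+m = cong +_ (ℕ.*-identityʳ (suc m))

2m/[1+m]*a+1/[1+m]*2a≡2a : ∀ m a →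
  (+ (2 ℕ.* m) / suc m) ℚ.* (+ a / 1) ℚ.+ (+ 1 / suc m) ℚ.* (+ (2 ℕ.* a) / 1) ≡ + (2 ℕ.* a) / 1
2m/[1+m]*a+1/[1+m]*2a≡2a m a = ℚ.toℚᵘ-injective (begin
  ℚ.toℚᵘ (p ℚ.* q ℚ.+ r ℚ.* s)
    ≈⟨ ℚ.toℚᵘ-homo-+ (p ℚ.* q) (r ℚ.* s) ⟩
  ℚ.toℚᵘ (p ℚ.* q) ℚᵘ.+ ℚ.toℚᵘ (r ℚ.* s)
    ≈⟨ ℚᵘ.+-cong (ℚ.toℚᵘ-homo-* p q) (ℚ.toℚᵘ-homo-* r s) ⟩
  ℚ.toℚᵘ p ℚᵘ.* ℚ.toℚᵘ q ℚᵘ.+ ℚ.toℚᵘ r ℚᵘ.* ℚ.toℚᵘ s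
    ≈⟨ ℚᵘ.+-cong (ℚᵘ.*-cong (toℚᵘ-/ (+ (2 ℕ.* m)) m) (toℚᵘ-/ (+ a) 0))
                 (ℚᵘ.*-cong (toℚᵘ-/ (+ 1) m) (toℚᵘ-/ (+ (2 ℕ.* a)) 0)) ⟩
  mkℚᵘ (+ (2 ℕ.* m)) m ℚᵘ.* mkℚᵘ (+ a) 0 ℚᵘ.+ mkℚᵘ (+ 1) m ℚᵘ.* mkℚᵘ (+ (2 ℕ.* a)) 0
    ≈⟨ 2m/[1+m]*a+1/[1+m]*2a≃2a m a ⟩
  mkℚᵘ (+ (2 ℕ.* a)) 0
    ≈⟨ toℚᵘ-/ (+ (2 ℕ.* a)) 0 ⟨
  ℚ.toℚᵘ s ∎)
  where
  open ℚᵘ.≃-Reasoning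

  toℚᵘ-/ : ∀ i d → ℚ.toℚᵘ (i / suc d) ℚᵘ.≃ mkℚᵘ i d
  toℚᵘ-/ i d = ℚ.toℚᵘ-fromℚᵘ (mkℚᵘ i d)

  p q r s : ℚ
  p = + (2 ℕ.* m) / suc m
  q = + a / 1
  r = + 1 / suc m
  s = + (2 ℕ.* a) / 1

open ≡-Reasoning

sumBelow-cong : ∀ n {f g : ℕ → ℤ} → (∀ j → j < n → f j ≡ g j) → sumBelow n f ≡ sumBelow n g
sumBelow-cong zero    f≗g = refl
sumBelow-cong (suc n) f≗g =
  cong₂ _+_ (sumBelow-cong n (λ j j<n → f≗g j (ℕ.m<n⇒m<1+n j<n))) (f≗g n ℕ.≤-refl)

sumBelow-+ : ∀ n (f g : ℕ → ℤ) → sumBelow n (λ j → f j + g j) ≡ sumBelow n f + sumBelow n g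
sumBelow-+ zero    f g = refl
sumBelow-+ (suc n) f g = begin
  sumBelow n (λ j → f j + g j) + (f n + g n) ≡⟨ cong (_+ (f n + g n)) (sumBelow-+ n f g) ⟩
  (sumBelow n f + sumBelow n g) + (f n + g n) ≡⟨ solve 4 (λ a b c d → (a :+ b) :+ (c :+ d) := (a :+ c) :+ (b :+ d))
                                                   refl (sumBelow n f) (sumBelow n g) (f n) (g n) ⟩
  (sumBelow n f + f n) + (sumBelow n g + g n) ∎
  where open +-*-Solver

sumBelow-suc : ∀ n (f : ℕ → ℤ) → sumBelow (suc n) f ≡ f 0 + sumBelow n (f ∘ suc)
sumBelow-suc zero    f = ℤ.+-comm 0ℤ (f 0)
sumBelow-suc (suc n) f = begin
  sumBelow (suc n) f + f (suc n)         ≡⟨ cong (_+ f (suc n)) (sumBelow-suc n f) ⟩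
  (f 0 + sumBelow n (f ∘ suc)) + f (suc n) ≡⟨ ℤ.+-assoc (f 0) _ _ ⟩
  f 0 + sumBelow (suc n) (f ∘ suc)       ∎

-- Summation by parts against Pascal's rule; the boundary term C(n, n+1) b (n+1) vanishes.
sumBelow-pascal : ∀ n (b : ℕ → ℤ) →
  sumBelow (suc (suc n)) (λ j → + (suc n C j) * b j)
    ≡ sumBelow (suc n) (λ j → + (n C j) * (b j + b (suc j)))
sumBelow-pascal n b = begin
  sumBelow (suc (suc n)) (λ j → + (suc n C j) * b j)
    ≡⟨ sumBelow-suc (suc n) _ ⟩
  1ℤ * b 0 + sumBelow (suc n) (λ j → + (suc n C suc j) * b (suc j))
    ≡⟨ cong (λ s → 1ℤ * b 0 + s) (trans (sumBelow-cong (suc n) (λ j _ → pascal j)) (sumBelow-+ (suc n) _ _)) ⟩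
  1ℤ * b 0 + (sumBelow (suc n) upper + sumBelow (suc n) (λ j → + (n C j) * b (suc j)))
    ≡⟨ sym (ℤ.+-assoc (1ℤ * b 0) _ _) ⟩
  (1ℤ * b 0 + sumBelow (suc n) upper) + sumBelow (suc n) (λ j → + (n C j) * b (suc j))
    ≡⟨ cong (λ s → (1ℤ * b 0 + s) + sumBelow (suc n) (λ j → + (n C j) * b (suc j))) dropLast ⟩
  (1ℤ * b 0 + sumBelow n upper) + sumBelow (suc n) (λ j → + (n C j) * b (suc j))
    ≡⟨ cong (_+ sumBelow (suc n) (λ j → + (n C j) * b (suc j))) (sym (sumBelow-suc n (λ j → + (n C j) * b j))) ⟩
  sumBelow (suc n) (λ j → + (n C j) * b j) + sumBelow (suc n) (λ j → + (n C j) * b (suc j))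
    ≡⟨ sym (sumBelow-+ (suc n) _ _) ⟩
  sumBelow (suc n) (λ j → + (n C j) * b j + + (n C j) * b (suc j))
    ≡⟨ sumBelow-cong (suc n) (λ j _ → sym (ℤ.*-distribˡ-+ (+ (n C j)) (b j) (b (suc j)))) ⟩
  sumBelow (suc n) (λ j → + (n C j) * (b j + b (suc j))) ∎
  where
  upper : ℕ → ℤ
  upper j = + (n C suc j) * b (suc j)

  pascal : ∀ j → + (suc n C suc j) * b (suc j) ≡ upper j + + (n C j) * b (suc j)
  pascal j = begin
    + (suc n C suc j) * b (suc j)              ≡⟨ cong (λ c → + c * b (suc j)) (sym (nCk+nC[k+1]≡[n+1]C[k+1] n j)) ⟩
    (+ (n C j) + + (n C suc j)) * b (suc j)    ≡⟨ ℤ.*-distribʳ-+ (b (suc j)) (+ (n C j)) (+ (n C suc j)) ⟩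
    + (n C j) * b (suc j) + upper j            ≡⟨ ℤ.+-comm _ (upper j) ⟩
    upper j + + (n C j) * b (suc j)            ∎

  dropLast : sumBelow (suc n) upper ≡ sumBelow n upper
  dropLast = begin
    sumBelow n upper + + (n C suc n) * b (suc n) ≡⟨ cong (λ c → sumBelow n upper + + c * b (suc n)) (k>n⇒nCk≡0 (ℕ.n<1+n n)) ⟩
    sumBelow n upper + 0ℤ                      ≡⟨ ℤ.+-identityʳ _ ⟩
    sumBelow n upper                           ∎

∇₂ : (ℕ → ℤ) → ℕ → ℤ
∇₂ f x = f x - f (x ∸ 2)

∇₂^ : ℕ → (ℕ → ℤ) → ℕ → ℤ
∇₂^ n f x = sumBelow (suc n) (λ j → sign j * (+ (n C j) * f (x ∸ 2 ℕ.* j)))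

x∸2j∸2≡x∸2[1+j] : ∀ x j → x ∸ 2 ℕ.* j ∸ 2 ≡ x ∸ 2 ℕ.* suc j
x∸2j∸2≡x∸2[1+j] x j = begin
  x ∸ 2 ℕ.* j ∸ 2     ≡⟨ ℕ.∸-+-assoc x (2 ℕ.* j) 2 ⟩
  x ∸ (2 ℕ.* j ℕ.+ 2) ≡⟨ cong (x ∸_) (ℕ.+-comm (2 ℕ.* j) 2) ⟩
  x ∸ (2 ℕ.+ 2 ℕ.* j) ≡⟨ cong (x ∸_) (sym (ℕ.*-suc 2 j)) ⟩
  x ∸ 2 ℕ.* suc j     ∎

∇₂^-suc : ∀ n f x → ∇₂^ (suc n) f x ≡ ∇₂^ n (∇₂ f) x
∇₂^-suc n f x = begin
  ∇₂^ (suc n) f x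
    ≡⟨ sumBelow-cong (suc (suc n)) (λ j _ → reorder (sign j) (+ (suc n C j)) _) ⟩
  sumBelow (suc (suc n)) (λ j → + (suc n C j) * b j)
    ≡⟨ sumBelow-pascal n b ⟩
  sumBelow (suc n) (λ j → + (n C j) * (b j + b (suc j)))
    ≡⟨ sumBelow-cong (suc n) (λ j _ → difference j) ⟩
  ∇₂^ n (∇₂ f) x ∎
  where
  open +-*-Solver

  b : ℕ → ℤ
  b j = sign j * f (x ∸ 2 ℕ.* j)

  reorder : ∀ s c y → s * (c * y) ≡ c * (s * y)
  reorder = solve 3 (λ s c y → s :* (c :* y) := c :* (s :* y)) refl

  difference : ∀ j → + (n C j) * (b j + b (suc j)) ≡ sign j * (+ (n C j) * ∇₂ f (x ∸ 2 ℕ.* j))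
  difference j rewrite x∸2j∸2≡x∸2[1+j] x j =
    solve 4 (λ s c y z → c :* (s :* y :+ :- s :* z) := s :* (c :* (y :- z))) refl
      (sign j) (+ (n C j)) (f (x ∸ 2 ℕ.* j)) (f (x ∸ 2 ℕ.* suc j))

∇₂^-+ : ∀ n f g x → ∇₂^ n (λ y → f y + g y) x ≡ ∇₂^ n f x + ∇₂^ n g x
∇₂^-+ n f g x = trans (sumBelow-cong (suc n) (λ j _ → distrib (sign j) (+ (n C j)) _ _)) (sumBelow-+ (suc n) _ _)
  where
  open +-*-Solver

  distrib : ∀ s c y z → s * (c * (y + z)) ≡ s * (c * y) + s * (c * z)
  distrib = solve 4 (λ s c y z → s :* (c :* (y :+ z)) := s :* (c :* y) :+ s :* (c :* z)) refl

∇₂^-∸ : ∀ n f k x → ∇₂^ n (λ y → f (y ∸ k)) x ≡ ∇₂^ n f (x ∸ k)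
∇₂^-∸ n f k x = sumBelow-cong (suc n) (λ j _ → cong (λ y → sign j * (+ (n C j) * f y)) (swap j))
  where
  swap : ∀ j → x ∸ 2 ℕ.* j ∸ k ≡ x ∸ k ∸ 2 ℕ.* j
  swap j = begin
    x ∸ 2 ℕ.* j ∸ k     ≡⟨ ℕ.∸-+-assoc x (2 ℕ.* j) k ⟩
    x ∸ (2 ℕ.* j ℕ.+ k) ≡⟨ cong (x ∸_) (ℕ.+-comm (2 ℕ.* j) k) ⟩
    x ∸ (k ℕ.+ 2 ℕ.* j) ≡⟨ sym (ℕ.∸-+-assoc x k (2 ℕ.* j)) ⟩
    x ∸ k ∸ 2 ℕ.* j     ∎

∇₂^-cong : ∀ n {f g} x → (∀ y → x ∸ 2 ℕ.* n ≤ y → f y ≡ g y) → ∇₂^ n f x ≡ ∇₂^ n g x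
∇₂^-cong n x f≗g = sumBelow-cong (suc n) (λ j j≤n →
  cong (λ v → sign j * (+ (n C j) * v)) (f≗g _ (ℕ.∸-monoʳ-≤ x (ℕ.*-monoʳ-≤ 2 (ℕ.≤-pred j≤n)))))

∇₂-C : ∀ n y → 2 ≤ y → ∇₂ (λ z → + (z C suc n)) y ≡ + ((y ∸ 1) C n) + + ((y ∸ 2) C n)
∇₂-C n (suc (suc w)) (s≤s (s≤s _)) = begin
  + (suc (suc w) C suc n) - + (w C suc n)
    ≡⟨ cong (λ c → + c - + (w C suc n)) (sym (nCk+nC[k+1]≡[n+1]C[k+1] (suc w) n)) ⟩
  + (suc w C n ℕ.+ suc w C suc n) - + (w C suc n)
    ≡⟨ cong (λ c → + (suc w C n ℕ.+ c) - + (w C suc n)) (sym (nCk+nC[k+1]≡[n+1]C[k+1] w n)) ⟩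
  + (suc w C n) + (+ (w C n) + + (w C suc n)) - + (w C suc n)
    ≡⟨ solve 3 (λ a b c → a :+ (b :+ c) :- c := a :+ b) refl (+ (suc w C n)) (+ (w C n)) (+ (w C suc n)) ⟩
  + (suc w C n) + + (w C n) ∎
  where open +-*-Solver

∇₂^-C : ∀ n x → 2 ℕ.* n ≤ x → ∇₂^ n (λ y → + (y C n)) x ≡ + (2 ^ n)
∇₂^-C zero    x _  = refl
∇₂^-C (suc n) x 2[1+n]≤x = begin
  ∇₂^ (suc n) C[_,1+n] x
    ≡⟨ ∇₂^-suc n C[_,1+n] x ⟩
  ∇₂^ n (∇₂ C[_,1+n]) x
    ≡⟨ ∇₂^-cong n x (λ y x∸2n≤y → ∇₂-C n y (ℕ.≤-trans 2≤x∸2n x∸2n≤y)) ⟩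
  ∇₂^ n (λ y → C[_,n] (y ∸ 1) + C[_,n] (y ∸ 2)) x
    ≡⟨ ∇₂^-+ n (λ y → C[_,n] (y ∸ 1)) (λ y → C[_,n] (y ∸ 2)) x ⟩
  ∇₂^ n (λ y → C[_,n] (y ∸ 1)) x + ∇₂^ n (λ y → C[_,n] (y ∸ 2)) x
    ≡⟨ cong₂ _+_ (∇₂^-∸ n C[_,n] 1 x) (∇₂^-∸ n C[_,n] 2 x) ⟩
  ∇₂^ n C[_,n] (x ∸ 1) + ∇₂^ n C[_,n] (x ∸ 2)
    ≡⟨ cong₂ _+_ (∇₂^-C n (x ∸ 1) 2n≤x∸1) (∇₂^-C n (x ∸ 2) 2n≤x∸2) ⟩
  + (2 ^ n ℕ.+ 2 ^ n)
    ≡⟨ cong (λ k → + (2 ^ n ℕ.+ k)) (sym (ℕ.+-identityʳ (2 ^ n))) ⟩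
  + (2 ^ suc n) ∎
  where
  C[_,n] C[_,1+n] : ℕ → ℤ
  C[ y ,n] = + (y C n)
  C[ y ,1+n] = + (y C suc n)

  2+2n≤x : 2 ℕ.+ 2 ℕ.* n ≤ x
  2+2n≤x = ℕ.≤-trans (ℕ.≤-reflexive (sym (ℕ.*-suc 2 n))) 2[1+n]≤x

  2≤x∸2n : 2 ≤ x ∸ 2 ℕ.* n
  2≤x∸2n = ℕ.m+n≤o⇒m≤o∸n 2 2+2n≤x

  2n≤x∸2 : 2 ℕ.* n ≤ x ∸ 2
  2n≤x∸2 = ℕ.m+n≤o⇒m≤o∸n (2 ℕ.* n) (ℕ.≤-trans (ℕ.≤-reflexive (ℕ.+-comm (2 ℕ.* n) 2)) 2+2n≤x)

  2n≤x∸1 : 2 ℕ.* n ≤ x ∸ 1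
  2n≤x∸1 = ℕ.≤-trans 2n≤x∸2 (ℕ.∸-monoʳ-≤ x (s≤s z≤n))

signedBinomialSum≡2^ : ∀ n y c → 2 ℕ.* n ≤ y →
  sumBelow (suc n) (λ j → sign j * + ((n C j) ℕ.* ((y ∸ 2 ℕ.* j ℕ.+ c) C n))) ≡ + (2 ^ n)
signedBinomialSum≡2^ n y c 2n≤y =
  trans (sumBelow-cong (suc n) term) (∇₂^-C n (y ℕ.+ c) (ℕ.≤-trans 2n≤y (ℕ.m≤m+n y c)))
  where
  term : ∀ j → j < suc n →
         sign j * + ((n C j) ℕ.* ((y ∸ 2 ℕ.* j ℕ.+ c) C n)) ≡ sign j * (+ (n C j) * + ((y ℕ.+ c ∸ 2 ℕ.* j) C n))
  term j (s≤s j≤n) = cong (sign j *_) (begin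
    + ((n C j) ℕ.* ((y ∸ 2 ℕ.* j ℕ.+ c) C n))   ≡⟨ ℤ.pos-* (n C j) _ ⟩
    + (n C j) * + ((y ∸ 2 ℕ.* j ℕ.+ c) C n)   ≡⟨ cong (λ z → + (n C j) * + (z C n)) (sym (ℕ.+-∸-comm c 2j≤y)) ⟩
    + (n C j) * + ((y ℕ.+ c ∸ 2 ℕ.* j) C n)   ∎)
    where
    2j≤y : 2 ℕ.* j ≤ y
    2j≤y = ℕ.≤-trans (ℕ.*-monoʳ-≤ 2 j≤n) 2n≤y

corollary2p5 : (m : ℕ) →
    (+ (2 ^ m)) / 1
      ≡ ((+ (2 ℕ.* m)) / suc m) ℚ.* (sumBelow m (λ j → sign j ℤ.* (+ (((m ∸ 1) C j) ℕ.* (((4 ℕ.* m ∸ 2 ℕ.* j) ℕ.+ 1) C (m ∸ 1))))) / 1)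
        ℚ.+ ((+ 1) / suc m) ℚ.* (sumBelow (suc m) (λ j → sign j ℤ.* (+ ((m C j) ℕ.* (((4 ℕ.* m ∸ 2 ℕ.* j) ℕ.+ 2) C m)))) / 1)
corollary2p5 zero    = refl
corollary2p5 (suc k) = begin
  + (2 ^ suc k) / 1
    ≡⟨ 2m/[1+m]*a+1/[1+m]*2a≡2a (suc k) (2 ^ k) ⟨
  (+ (2 ℕ.* suc k) / suc (suc k)) ℚ.* (+ (2 ^ k) / 1) ℚ.+ (+ 1 / suc (suc k)) ℚ.* (+ (2 ^ suc k) / 1)
    ≡⟨ cong₂ (λ a b → (+ (2 ℕ.* suc k) / suc (suc k)) ℚ.* (a / 1) ℚ.+ (+ 1 / suc (suc k)) ℚ.* (b / 1))
             (signedBinomialSum≡2^ k (4 ℕ.* suc k) 1 2k≤4[1+k]) (signedBinomialSum≡2^ (suc k) (4 ℕ.* suc k) 2 2[1+k]≤4[1+k]) ⟨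
  _ ∎
  where
  2[1+k]≤4[1+k] : 2 ℕ.* suc k ≤ 4 ℕ.* suc k
  2[1+k]≤4[1+k] = ℕ.*-monoˡ-≤ (suc k) {2} {4} (s≤s (s≤s z≤n))

  2k≤4[1+k] : 2 ℕ.* k ≤ 4 ℕ.* suc k
  2k≤4[1+k] = ℕ.≤-trans (ℕ.*-monoʳ-≤ 2 (ℕ.n≤1+n k)) 2[1+k]≤4[1+k]
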